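{- For every integer $q\ge 2$, $\theta(\overline{KM_q})=\alpha(\overline{KM_q})=2q$.
   Context: For $q\ge 2$, $\overline{ME_q}$ is the graph with the $4q+2$ vertices $u_0,u_1,\dots,u_{q+1}$ and $v_{i1},v_{i2},v_{i3}$ ($i=1,\dots,q$), whose edges are: the edges of the Hamiltonian cycle $u_0,u_1,\dots,u_{q+1},v_{11},v_{12},v_{13},v_{21},v_{22},v_{23},\dots,v_{q1},v_{q2},v_{q3},u_0$; the edges $u_iv_{i2}$ for $i=1,\dots,q$; and the edges $v_{i1}v_{i3}$ for $i=1,\dots,q$. $\overline{KM_q}$ is obtained from $\overline{ME_q}$ by deleting the edges $u_1u_2,u_2u_3,\dots,u_{q-1}u_q$. $\theta(H)$ is the clique partition number (minimum number of cliques partitioning $V(H)$) and $\alpha(H)$ the maximum size of an independent set. -}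

module Defs where

open import Data.Nat using (ℕ; zero; suc; _+_; _*_; _∸_; _≤_)
open import Data.Fin using (Fin; toℕ)
open import Data.List using (List; length)
open import Data.List.Relation.Unary.AllPairs using (AllPairs)
open import Data.Product using (Σ; _×_; ∃-syntax)
open import Data.Sum using (_⊎_)
open import Relation.Nullary using (¬_)
open import Relation.Binary.PropositionalEquality using (_≡_; _≢_)

IsIndependent : {V : Set} → (V → V → Set) → List V → Set
IsIndependent Adj S = AllPairs (λ x y → x ≢ y × ¬ Adj x y) S

IsIndependenceNumber : {V : Set} → (V → V → Set) → ℕ → Set
IsIndependenceNumber {V} Adj n =
  (Σ (List V) λ S → IsIndependent Adj S × length S ≡ n) ×
  ((S : List V) → IsIndependent Adj S → length S ≤ n)

-- A partition of V into (at most) k cliques, given by assigning each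
-- vertex a class in Fin k such that each class is a clique.
IsCliquePartition : {V : Set} → (V → V → Set) → (k : ℕ) → (V → Fin k) → Set
IsCliquePartition {V} Adj k c = (x y : V) → x ≢ y → c x ≡ c y → Adj x y

IsCliquePartitionNumber : {V : Set} → (V → V → Set) → ℕ → Set
IsCliquePartitionNumber {V} Adj n =
  (Σ (V → Fin n) λ c → IsCliquePartition Adj n c) ×
  ((k : ℕ) (c : V → Fin k) → IsCliquePartition Adj k c → n ≤ k)

-- The graph KM_q-bar.  Vertices: u a (a = 0..q+1) and v i j, where the
-- paper's v_{i',j'} (i' = 1..q, j' = 1..3) is  v i j  with
-- toℕ i = i' - 1 and toℕ j = j' - 1.

data V (q : ℕ) : Set where
  u : Fin (suc (suc q)) → V q
  v : Fin q → Fin 3 → V q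

data E (q : ℕ) : V q → V q → Set where
  -- Hamiltonian cycle edges that are kept: u0u1 and u_q u_{q+1}
  -- (the edges u1u2, ..., u_{q-1}u_q are deleted)
  e-u0u1  : {a b : Fin (suc (suc q))} → toℕ a ≡ 0 → toℕ b ≡ 1 → E q (u a) (u b)
  e-uquq1 : {a b : Fin (suc (suc q))} → toℕ a ≡ q → toℕ b ≡ suc q → E q (u a) (u b)
  e-uv11  : {a : Fin (suc (suc q))} {i : Fin q} → toℕ a ≡ suc q → toℕ i ≡ 0 →
            E q (u a) (v i Fin.zero)
  e-v12   : {i : Fin q} → E q (v i Fin.zero) (v i (Fin.suc Fin.zero))
  e-v23   : {i : Fin q} → E q (v i (Fin.suc Fin.zero)) (v i (Fin.suc (Fin.suc Fin.zero)))
  e-v3v1  : {i j : Fin q} → toℕ j ≡ suc (toℕ i) →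
            E q (v i (Fin.suc (Fin.suc Fin.zero))) (v j Fin.zero)
  e-vq3u0 : {i : Fin q} {a : Fin (suc (suc q))} → suc (toℕ i) ≡ q → toℕ a ≡ 0 →
            E q (v i (Fin.suc (Fin.suc Fin.zero))) (u a)
  e-uv2   : {a : Fin (suc (suc q))} {i : Fin q} → toℕ a ≡ suc (toℕ i) →
            E q (u a) (v i (Fin.suc Fin.zero))
  e-v13   : {i : Fin q} → E q (v i Fin.zero) (v i (Fin.suc (Fin.suc Fin.zero)))

KMAdj : (q : ℕ) → V q → V q → Set
KMAdj q x y = E q x y ⊎ E q y x

{-# OPTIONS --safe #-}
-- Weak duality: the vertices of an independent set lie in pairwise different
-- cliques of any clique partition, so α ≤ θ, and it suffices to exhibit an
-- independent set and a clique partition of the same size 2q.  The set is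
-- {u₁, …, u_q, v₁₁, …, v_q1}; the partition consists of the q triangles
-- {v_i1, v_i2, v_i3}, the edges u₀u₁ and u_q u_{q+1}, and the singletons
-- {u₂}, …, {u_{q-1}}.
module Submission where

open import Defs
open import Data.Nat using (ℕ; zero; suc; _+_; _*_; _∸_; _⊓_; _≤_; _<_; s≤s; _≤?_)
open import Data.Nat.Properties
  using (suc-injective; ≤-pred; ≤-trans; ≰⇒>; <⇒≱; m≤m+n; m⊓n≤n; +-monoʳ-<; +-cancelˡ-≡; +-identityʳ)
open import Data.Fin using (Fin; toℕ; fromℕ<; inject₁) renaming (zero to fz; suc to fs)
import Data.Fin as Fin
open import Data.Fin.Properties as Finₚ
  using (toℕ-injective; toℕ<n; toℕ-fromℕ<; toℕ-inject₁-≢; inject₁-injective; pigeonhole)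
open import Data.List using (List; _∷_; length; lookup; tabulate; _++_)
open import Data.List.Properties using (length-++; length-tabulate)
open import Data.List.Membership.Propositional.Properties using (∈-lookup)
import Data.List.Relation.Unary.All as All
import Data.List.Relation.Unary.All.Properties as Allₚ
open import Data.List.Relation.Unary.AllPairs using (AllPairs; _∷_)
import Data.List.Relation.Unary.AllPairs.Properties as AllPairsₚ
open import Data.Product using (_×_; _,_)
open import Data.Sum using (_⊎_; inj₁; inj₂)
open import Data.Empty using (⊥-elim)
open import Relation.Nullary using (¬_; yes; no)
open import Relation.Binary.PropositionalEquality
open import Function using (_∘′_)

allPairs-lookup : ∀ {A : Set} {R : A → A → Set} {xs : List A} → AllPairs R xs →
                  ∀ {i j : Fin (length xs)} → i Fin.< j → R (lookup xs i) (lookup xs j)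
allPairs-lookup {xs = _ ∷ _}  (px ∷ _)   {fz}   {fs j} _       = All.lookup px (∈-lookup j)
allPairs-lookup {xs = _ ∷ _}  (_  ∷ pxs) {fs i} {fs j} (s≤s i<j) = allPairs-lookup pxs i<j

module _ {W : Set} {Adj : W → W → Set} where

  independent-length≤cliqueCount : ∀ {k} (c : W → Fin k) → IsCliquePartition Adj k c →
                                   (S : List W) → IsIndependent Adj S → length S ≤ k
  independent-length≤cliqueCount {k} c c-partition S S-independent with length S ≤? k
  ... | yes |S|≤k = |S|≤k
  ... | no  |S|≰k with pigeonhole (≰⇒> |S|≰k) (λ i → c (lookup S i))
  ... | i , j , i<j , same-clique with allPairs-lookup S-independent i<j
  ... | distinct , nonadjacent = ⊥-elim (nonadjacent (c-partition _ _ distinct same-clique))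

  θ≡α-from-witnesses : ∀ {n} (S : List W) → IsIndependent Adj S → length S ≡ n →
                       (c : W → Fin n) → IsCliquePartition Adj n c →
                       IsCliquePartitionNumber Adj n × IsIndependenceNumber Adj n
  θ≡α-from-witnesses S S-independent |S|≡n c c-partition =
    ((c , c-partition) ,
     λ k c′ c′-partition → subst (_≤ k) |S|≡n
                              (independent-length≤cliqueCount c′ c′-partition S S-independent)) ,
    ((S , S-independent , |S|≡n) ,
     independent-length≤cliqueCount c c-partition)

  cliquePartition-fromℕ : ∀ {k} (label : W → ℕ) (label<k : ∀ x → label x < k) →
                          (∀ x y → x ≢ y → label x ≡ label y → Adj x y) →
                          IsCliquePartition Adj k (λ x → fromℕ< (label<k x))
  cliquePartition-fromℕ label label<k same-label⇒adj x y x≢y same-class =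
    same-label⇒adj x y x≢y (begin
      label x                  ≡⟨ toℕ-fromℕ< (label<k x) ⟨
      toℕ (fromℕ< (label<k x)) ≡⟨ cong toℕ same-class ⟩
      toℕ (fromℕ< (label<k y)) ≡⟨ toℕ-fromℕ< (label<k y) ⟩
      label y                  ∎)
    where open ≡-Reasoning

⊓-collision : ∀ r {k k′} → k ≤ suc r → k′ ≤ suc r → k ≢ k′ → k ⊓ r ≡ k′ ⊓ r →
              (k ≡ r × k′ ≡ suc r) ⊎ (k ≡ suc r × k′ ≡ r)
⊓-collision zero    {zero}        {zero}        _        _         k≢k′ _ = ⊥-elim (k≢k′ refl)
⊓-collision zero    {zero}        {suc zero}    _        _         _    _ = inj₁ (refl , refl)
⊓-collision zero    {suc zero}    {zero}        _        _         _    _ = inj₂ (refl , refl)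
⊓-collision zero    {suc zero}    {suc zero}    _        _         k≢k′ _ = ⊥-elim (k≢k′ refl)
⊓-collision zero    {suc (suc _)} {_}           (s≤s ()) _         _    _
⊓-collision zero    {_}           {suc (suc _)} _        (s≤s ())  _    _
⊓-collision (suc r) {zero}        {zero}        _        _         k≢k′ _ = ⊥-elim (k≢k′ refl)
⊓-collision (suc r) {zero}        {suc _}       _        _         _    ()
⊓-collision (suc r) {suc _}       {zero}        _        _         _    ()
⊓-collision (suc r) {suc k} {suc k′} (s≤s k≤) (s≤s k′≤) k≢k′ eq
  with ⊓-collision r k≤ k′≤ (k≢k′ ∘′ cong suc) (suc-injective eq)
... | inj₁ (k≡r , k′≡1+r) = inj₁ (cong suc k≡r , cong suc k′≡1+r)
... | inj₂ (k≡1+r , k′≡r) = inj₂ (cong suc k≡1+r , cong suc k′≡r)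

module KM (r : ℕ) where

  q : ℕ
  q = suc (suc r)

  u-injective : ∀ {a b} → u {q} a ≡ u b → a ≡ b
  u-injective refl = refl

  u-inner : Fin q → V q
  u-inner i = u (fs (inject₁ i))

  v-first : Fin q → V q
  v-first i = v i fz

  independentSet : List (V q)
  independentSet = tabulate u-inner ++ tabulate v-first

  length-independentSet : length independentSet ≡ 2 * q
  length-independentSet = begin
    length (tabulate u-inner ++ tabulate v-first)          ≡⟨ length-++ (tabulate u-inner) ⟩
    length (tabulate u-inner) + length (tabulate v-first)  ≡⟨ cong₂ _+_ (length-tabulate u-inner) (length-tabulate v-first) ⟩
    q + q                                                  ≡⟨ cong (q +_) (+-identityʳ q) ⟨
    2 * q                                                  ∎
    where open ≡-Reasoning

  u-inner≢u-last : ∀ i → suc (toℕ (inject₁ i)) ≢ suc q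
  u-inner≢u-last i eq = toℕ-inject₁-≢ i (sym (suc-injective eq))

  u-inner-nonadjacent : ∀ i j → ¬ E q (u-inner i) (u-inner j)
  u-inner-nonadjacent i j (e-u0u1 () _)
  u-inner-nonadjacent i j (e-uquq1 _ j-last) = u-inner≢u-last j j-last

  NonAdjacentDistinct : V q → V q → Set
  NonAdjacentDistinct x y = x ≢ y × ¬ KMAdj q x y

  u-inner-independent : ∀ {i j} → i ≢ j → NonAdjacentDistinct (u-inner i) (u-inner j)
  u-inner-independent {i} {j} i≢j =
    (λ eq → i≢j (inject₁-injective (Finₚ.suc-injective (u-injective eq)))) ,
    λ { (inj₁ e) → u-inner-nonadjacent i j e ; (inj₂ e) → u-inner-nonadjacent j i e }

  v-first-independent : ∀ {i j} → i ≢ j → NonAdjacentDistinct (v-first i) (v-first j)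
  v-first-independent i≢j = (λ { refl → i≢j refl }) , λ { (inj₁ ()) ; (inj₂ ()) }

  u-inner-v-first-independent : ∀ i j → NonAdjacentDistinct (u-inner i) (v-first j)
  u-inner-v-first-independent i j =
    (λ ()) , λ { (inj₁ (e-uv11 i-last _)) → u-inner≢u-last i i-last ; (inj₂ ()) }

  independentSet-isIndependent : IsIndependent (KMAdj q) independentSet
  independentSet-isIndependent =
    AllPairsₚ.++⁺ (AllPairsₚ.tabulate⁺ u-inner-independent)
                  (AllPairsₚ.tabulate⁺ v-first-independent)
                  (Allₚ.tabulate⁺ λ i → Allₚ.tabulate⁺ (u-inner-v-first-independent i))

  -- (a ∸ 1) ⊓ (q ∸ 1) merges u₀ with u₁ and u_q with u_{q+1}, and nothing else.
  cliqueLabel : V q → ℕ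
  cliqueLabel (v i _) = toℕ i
  cliqueLabel (u a)   = q + (toℕ a ∸ 1) ⊓ suc r

  cliqueLabel<2q : ∀ x → cliqueLabel x < 2 * q
  cliqueLabel<2q (v i _) = ≤-trans (toℕ<n i) (m≤m+n q _)
  cliqueLabel<2q (u a)   = +-monoʳ-< q (s≤s (≤-trans (m⊓n≤n _ (suc r)) (m≤m+n (suc r) 0)))

  triangle : ∀ i j j′ → j ≢ j′ → KMAdj q (v i j) (v i j′)
  triangle i fz           fz           j≢j′ = ⊥-elim (j≢j′ refl)
  triangle i fz           (fs fz)      _    = inj₁ e-v12
  triangle i fz           (fs (fs fz)) _    = inj₁ e-v13
  triangle i (fs fz)      fz           _    = inj₂ e-v12
  triangle i (fs fz)      (fs fz)      j≢j′ = ⊥-elim (j≢j′ refl)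
  triangle i (fs fz)      (fs (fs fz)) _    = inj₁ e-v23
  triangle i (fs (fs fz)) fz           _    = inj₂ e-v13
  triangle i (fs (fs fz)) (fs fz)      _    = inj₂ e-v23
  triangle i (fs (fs fz)) (fs (fs fz)) j≢j′ = ⊥-elim (j≢j′ refl)

  u-sameLabel⇒adjacent : ∀ (a b : Fin (suc (suc q))) → a ≢ b →
                         (toℕ a ∸ 1) ⊓ suc r ≡ (toℕ b ∸ 1) ⊓ suc r → KMAdj q (u a) (u b)
  u-sameLabel⇒adjacent fz           fz           a≢b _  = ⊥-elim (a≢b refl)
  u-sameLabel⇒adjacent fz           (fs fz)      _   _  = inj₁ (e-u0u1 refl refl)
  u-sameLabel⇒adjacent (fs fz)      fz           _   _  = inj₂ (e-u0u1 refl refl)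
  u-sameLabel⇒adjacent (fs fz)      (fs fz)      a≢b _  = ⊥-elim (a≢b refl)
  u-sameLabel⇒adjacent fz           (fs (fs _))  _   ()
  u-sameLabel⇒adjacent (fs fz)      (fs (fs _))  _   ()
  u-sameLabel⇒adjacent (fs (fs _))  fz           _   ()
  u-sameLabel⇒adjacent (fs (fs _))  (fs fz)      _   ()
  u-sameLabel⇒adjacent (fs (fs a))  (fs (fs b))  a≢b eq
    with ⊓-collision r (≤-pred (toℕ<n a)) (≤-pred (toℕ<n b))
                     (a≢b ∘′ cong (fs ∘′ fs) ∘′ toℕ-injective) (suc-injective eq)
  ... | inj₁ (a≡r , b≡1+r) = inj₁ (e-uquq1 (cong (suc ∘′ suc) a≡r) (cong (suc ∘′ suc) b≡1+r))
  ... | inj₂ (a≡1+r , b≡r) = inj₂ (e-uquq1 (cong (suc ∘′ suc) b≡r) (cong (suc ∘′ suc) a≡1+r))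

  v-label≢u-label : ∀ (i : Fin q) m → toℕ i ≢ q + m
  v-label≢u-label i m eq = <⇒≱ (toℕ<n i) (subst (q ≤_) (sym eq) (m≤m+n q m))

  sameLabel⇒adjacent : ∀ x y → x ≢ y → cliqueLabel x ≡ cliqueLabel y → KMAdj q x y
  sameLabel⇒adjacent (v i j) (v i′ j′) x≢y eq with toℕ-injective eq
  ... | refl = triangle i j j′ (x≢y ∘′ cong (v i))
  sameLabel⇒adjacent (v i _) (u _)   _   eq = ⊥-elim (v-label≢u-label i _ eq)
  sameLabel⇒adjacent (u _)   (v i _) _   eq = ⊥-elim (v-label≢u-label i _ (sym eq))
  sameLabel⇒adjacent (u a)   (u b)   x≢y eq =
    u-sameLabel⇒adjacent a b (x≢y ∘′ cong u) (+-cancelˡ-≡ q _ _ eq)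

  cliqueClass : V q → Fin (2 * q)
  cliqueClass x = fromℕ< (cliqueLabel<2q x)

  cliqueClass-isCliquePartition : IsCliquePartition (KMAdj q) (2 * q) cliqueClass
  cliqueClass-isCliquePartition = cliquePartition-fromℕ cliqueLabel cliqueLabel<2q sameLabel⇒adjacent

theorem10 : (q : ℕ) → 2 ≤ q →
    IsCliquePartitionNumber (KMAdj q) (2 * q) × IsIndependenceNumber (KMAdj q) (2 * q)
theorem10 (suc zero)    (s≤s ())
theorem10 (suc (suc r)) _ =
  θ≡α-from-witnesses independentSet independentSet-isIndependent length-independentSet
                     cliqueClass cliqueClass-isCliquePartition
  where open KM r
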